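{- Let $\sigma$ be a countable signature and let $W^\sharp$ be the set of worlds described in the context. For every $\Gamma\in W^\sharp$ and every $\sigma^\star$-sentence $\Phi$: (i) $\Diamond\Phi\in\Gamma$ if and only if there exists $\Gamma'\in W^\sharp$ with $\Phi\in\Gamma'$ and $(\Gamma)_\Box\subseteq\Gamma'$; (ii) $\Box\Phi\in\Gamma$ if and only if $\Phi\in\Gamma'$ for every $\Gamma'\in W^\sharp$ with $(\Gamma)_\Box\subseteq\Gamma'$.
   Context: Signature: predicate symbols (with arities) and constants, no function symbols; terms are variables (fixed countable set) and constants. Formulas are built from atomic formulas and $\bot$ by $\rightarrow,\wedge,\vee$, strong negation $\sim$, $\Box,\Diamond$, $\forall x,\exists x$. $\neg\Phi:=\Phi\rightarrow\bot$, $\Phi\leftrightarrow\Psi:=(\Phi\rightarrow\Psi)\wedge(\Psi\rightarrow\Phi)$, $\Phi\Leftrightarrow\Psi:=(\Phi\leftrightarrow\Psi)\wedge({\sim\Phi}\leftrightarrow{\sim\Psi})$. For a signature $\tau$, $\mathsf{QBK}^\sharp_\tau$ is the smallest set of $\tau$-formulas containing all instances of: $\Phi\rightarrow(\Psi\rightarrow\Phi)$; $(\Phi\rightarrow(\Psi\rightarrow\Theta))\rightarrow((\Phi\rightarrow\Psi)\rightarrow(\Phi\rightarrow\Theta))$; $\Phi\wedge\Psi\rightarrow\Phi$; $\Phi\wedge\Psi\rightarrow\Psi$; $\Phi\rightarrow(\Psi\rightarrow\Phi\wedge\Psi)$; $\Phi\rightarrow\Phi\vee\Psi$; $\Psi\rightarrow\Phi\vee\Psi$;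 $(\Phi\rightarrow\Theta)\rightarrow((\Psi\rightarrow\Theta)\rightarrow(\Phi\vee\Psi\rightarrow\Theta))$; $\Phi\vee(\Phi\rightarrow\bot)$; $\bot\rightarrow\Phi$; ${\sim\sim\Phi}\leftrightarrow\Phi$; ${\sim(\Phi\rightarrow\Psi)}\leftrightarrow(\Phi\wedge{\sim\Psi})$; ${\sim(\Phi\vee\Psi)}\leftrightarrow({\sim\Phi}\wedge{\sim\Psi})$; ${\sim(\Phi\wedge\Psi)}\leftrightarrow({\sim\Phi}\vee{\sim\Psi})$; ${\sim\bot}$; $(\Box\Phi\wedge\Box\Psi)\rightarrow\Box(\Phi\wedge\Psi)$; $\Box(\Phi\rightarrow\Phi)$; $\neg\Box\Phi\leftrightarrow\Diamond\neg\Phi$; $\neg\Diamond\Phi\leftrightarrow\Box\neg\Phi$; $\Box\Phi\Leftrightarrow{\sim\Diamond{\sim\Phi}}$; $\Diamond\Phi\Leftrightarrow{\sim\Box{\sim\Phi}}$; $\forall x\Phi\rightarrow\Phi(x/t)$, $\Phi(x/t)\rightarrow\exists x\Phi$ ($t$ free for $x$); ${\sim\forall x\Phi}\leftrightarrow\exists x{\sim\Phi}$; ${\sim\exists x\Phi}\leftrightarrow\forall x{\sim\Phi}$; $\Diamond\exists x\Phi\rightarrow\exists x\Diamond\Phi$; closed under MP, MB (from $\Phi\rightarrow\Psi$ infer $\Box\Phi\rightarrow\Box\Psi$), MD (from $\Phi\rightarrow\Psi$ infer $\Diamond\Phi\rightarrow\Diamond\Psi$), BR1 (from $\Phi\rightarrow\Psi$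 infer $\Phi\rightarrow\forall x\Psi$, $x$ not free in $\Phi$), BR2 (from $\Phi\rightarrow\Psi$ infer $\exists x\Phi\rightarrow\Psi$, $x$ not free in $\Psi$). For a set $\Gamma$ of $\tau$-sentences and a $\tau$-sentence $\Phi$, $\Gamma\vdash_\sharp\Phi$ iff some finite disjunction $\Phi\vee\dots\vee\Phi$ (or $\bot$) is obtainable from $\Gamma\cup\mathsf{QBK}^\sharp_\tau$ by MP, BR1, BR2. Worlds. Fix a set $S^\star$ with $|S^\star|=|\mathrm{Sent}_\sigma|$ and let $\sigma^\star$ be $\sigma$ extended by new constants $\underline s$ ($s\in S^\star$). A $\sigma^\star$-theory $\Gamma$ is prime if $\Gamma\neq\mathrm{Sent}_{\sigma^\star}$, $\Gamma$ contains every $\sigma^\star$-sentence $\Phi$ with $\Gamma\vdash_\sharp\Phi$, and $\Phi\vee\Psi\in\Gamma$ implies $\Phi\in\Gamma$ or $\Psi\in\Gamma$; it is saturated if moreover for each $\exists x\Phi\in\Gamma$ there is a constant $c$ of $\sigma^\star$ with $\Phi(x/c)\in\Gamma$. $W^\sharp$ is the set of all saturated $\sigma^\star$-theories, and $(\Gamma)_\Box:=\{\Phi:\Box\Phi\in\Gamma\}$. -}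

module Defs where

open import Data.Nat using (ℕ; _≡ᵇ_)
open import Data.Bool using (Bool; true; false; _∨_; _∧_; not; if_then_else_)
open import Data.Vec using (Vec)
import Data.Vec as Vec
open import Data.Sum using (_⊎_; inj₁; inj₂)
open import Data.Product using (Σ; _×_; ∃-syntax)
open import Relation.Binary.PropositionalEquality using (_≡_)
open import Relation.Nullary using (¬_)
open import Function.Bundles using (_↣_)
open import Level using (0ℓ)

record Signature : Set₁ where
  field
    Pred  : Set
    arity : Pred → ℕ
    Const : Set

record Countable (σ : Signature) : Set where
  field
    predInj  : Signature.Pred σ ↣ ℕ
    constInj : Signature.Const σ ↣ ℕ

module Syntax (σ : Signature) where
  open Signature σ

  data Term (C : Set) : Set where
    var : ℕ → Term C
    con : C → Term C

  infixr 6 _⇒_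
  infixr 7 _∨'_
  infixr 8 _∧'_
  infix  9 ∼_ □_ ◇_

  data Form (C : Set) : Set where
    atom  : (p : Pred) → Vec (Term C) (arity p) → Form C
    ⊥'    : Form C
    _⇒_   : Form C → Form C → Form C
    _∧'_  : Form C → Form C → Form C
    _∨'_  : Form C → Form C → Form C
    ∼_    : Form C → Form C
    □_    : Form C → Form C
    ◇_    : Form C → Form C
    ∀'    : ℕ → Form C → Form C
    ∃'    : ℕ → Form C → Form C

  module _ {C : Set} where

    ¬'_ : Form C → Form C
    ¬' Φ = Φ ⇒ ⊥'

    _↔'_ : Form C → Form C → Form C
    Φ ↔' Ψ = (Φ ⇒ Ψ) ∧' (Ψ ⇒ Φ)

    _⟺_ : Form C → Form C → Form C
    Φ ⟺ Ψ = (Φ ↔' Ψ) ∧' ((∼ Φ) ↔' (∼ Ψ))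

    termHasVar : ℕ → Term C → Bool
    termHasVar x (var y) = x ≡ᵇ y
    termHasVar x (con c) = false

    anyTerm : ∀ {n} → ℕ → Vec (Term C) n → Bool
    anyTerm x Vec.[] = false
    anyTerm x (t Vec.∷ ts) = termHasVar x t ∨ anyTerm x ts

    occursFree : ℕ → Form C → Bool
    occursFree x (atom p ts) = anyTerm x ts
    occursFree x ⊥' = false
    occursFree x (Φ ⇒ Ψ) = occursFree x Φ ∨ occursFree x Ψ
    occursFree x (Φ ∧' Ψ) = occursFree x Φ ∨ occursFree x Ψ
    occursFree x (Φ ∨' Ψ) = occursFree x Φ ∨ occursFree x Ψ
    occursFree x (∼ Φ) = occursFree x Φ
    occursFree x (□ Φ) = occursFree x Φ
    occursFree x (◇ Φ) = occursFree x Φ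
    occursFree x (∀' y Φ) = not (x ≡ᵇ y) ∧ occursFree x Φ
    occursFree x (∃' y Φ) = not (x ≡ᵇ y) ∧ occursFree x Φ

    NotFree : ℕ → Form C → Set
    NotFree x Φ = occursFree x Φ ≡ false

    Sentence : Form C → Set
    Sentence Φ = ∀ x → NotFree x Φ

    substT : ℕ → Term C → Term C → Term C
    substT x t (var y) = if x ≡ᵇ y then t else var y
    substT x t (con c) = con c

    substTs : ∀ {n} → ℕ → Term C → Vec (Term C) n → Vec (Term C) n
    substTs x t Vec.[] = Vec.[]
    substTs x t (s Vec.∷ ss) = substT x t s Vec.∷ substTs x t ss

    _[_/_] : Form C → ℕ → Term C → Form C
    atom p ts [ x / t ] = atom p (substTs x t ts)
    ⊥' [ x / t ] = ⊥'
    (Φ ⇒ Ψ) [ x / t ] = (Φ [ x / t ]) ⇒ (Ψ [ x / t ])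
    (Φ ∧' Ψ) [ x / t ] = (Φ [ x / t ]) ∧' (Ψ [ x / t ])
    (Φ ∨' Ψ) [ x / t ] = (Φ [ x / t ]) ∨' (Ψ [ x / t ])
    (∼ Φ) [ x / t ] = ∼ (Φ [ x / t ])
    (□ Φ) [ x / t ] = □ (Φ [ x / t ])
    (◇ Φ) [ x / t ] = ◇ (Φ [ x / t ])
    ∀' y Φ [ x / t ] = if x ≡ᵇ y then ∀' y Φ else ∀' y (Φ [ x / t ])
    ∃' y Φ [ x / t ] = if x ≡ᵇ y then ∃' y Φ else ∃' y (Φ [ x / t ])

    freeForB : Term C → ℕ → Form C → Bool
    freeForB t x (atom p ts) = true
    freeForB t x ⊥' = true
    freeForB t x (Φ ⇒ Ψ) = freeForB t x Φ ∧ freeForB t x Ψ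
    freeForB t x (Φ ∧' Ψ) = freeForB t x Φ ∧ freeForB t x Ψ
    freeForB t x (Φ ∨' Ψ) = freeForB t x Φ ∧ freeForB t x Ψ
    freeForB t x (∼ Φ) = freeForB t x Φ
    freeForB t x (□ Φ) = freeForB t x Φ
    freeForB t x (◇ Φ) = freeForB t x Φ
    freeForB t x (∀' y Φ) =
      not (occursFree x (∀' y Φ)) ∨ (not (termHasVar y t) ∧ freeForB t x Φ)
    freeForB t x (∃' y Φ) =
      not (occursFree x (∃' y Φ)) ∨ (not (termHasVar y t) ∧ freeForB t x Φ)

    FreeFor : Term C → ℕ → Form C → Set
    FreeFor t x Φ = freeForB t x Φ ≡ true

    data QBK : Form C → Set where
      ax1  : ∀ Φ Ψ → QBK (Φ ⇒ (Ψ ⇒ Φ))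
      ax2  : ∀ Φ Ψ Θ → QBK ((Φ ⇒ (Ψ ⇒ Θ)) ⇒ ((Φ ⇒ Ψ) ⇒ (Φ ⇒ Θ)))
      ax3  : ∀ Φ Ψ → QBK ((Φ ∧' Ψ) ⇒ Φ)
      ax4  : ∀ Φ Ψ → QBK ((Φ ∧' Ψ) ⇒ Ψ)
      ax5  : ∀ Φ Ψ → QBK (Φ ⇒ (Ψ ⇒ (Φ ∧' Ψ)))
      ax6  : ∀ Φ Ψ → QBK (Φ ⇒ (Φ ∨' Ψ))
      ax7  : ∀ Φ Ψ → QBK (Ψ ⇒ (Φ ∨' Ψ))
      ax8  : ∀ Φ Ψ Θ → QBK ((Φ ⇒ Θ) ⇒ ((Ψ ⇒ Θ) ⇒ ((Φ ∨' Ψ) ⇒ Θ)))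
      ax9  : ∀ Φ → QBK (Φ ∨' (Φ ⇒ ⊥'))
      ax10 : ∀ Φ → QBK (⊥' ⇒ Φ)
      sn1  : ∀ Φ → QBK ((∼ ∼ Φ) ↔' Φ)
      sn2  : ∀ Φ Ψ → QBK ((∼ (Φ ⇒ Ψ)) ↔' (Φ ∧' ∼ Ψ))
      sn3  : ∀ Φ Ψ → QBK ((∼ (Φ ∨' Ψ)) ↔' (∼ Φ ∧' ∼ Ψ))
      sn4  : ∀ Φ Ψ → QBK ((∼ (Φ ∧' Ψ)) ↔' (∼ Φ ∨' ∼ Ψ))
      sn5  : QBK (∼ ⊥')
      md1  : ∀ Φ Ψ → QBK ((□ Φ ∧' □ Ψ) ⇒ □ (Φ ∧' Ψ))
      md2  : ∀ Φ → QBK (□ (Φ ⇒ Φ))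
      md3  : ∀ Φ → QBK ((¬' (□ Φ)) ↔' (◇ (¬' Φ)))
      md4  : ∀ Φ → QBK ((¬' (◇ Φ)) ↔' (□ (¬' Φ)))
      md5  : ∀ Φ → QBK ((□ Φ) ⟺ (∼ ◇ ∼ Φ))
      md6  : ∀ Φ → QBK ((◇ Φ) ⟺ (∼ □ ∼ Φ))
      q1   : ∀ x Φ t → FreeFor t x Φ → QBK (∀' x Φ ⇒ (Φ [ x / t ]))
      q2   : ∀ x Φ t → FreeFor t x Φ → QBK ((Φ [ x / t ]) ⇒ ∃' x Φ)
      q3   : ∀ x Φ → QBK ((∼ ∀' x Φ) ↔' ∃' x (∼ Φ))
      q4   : ∀ x Φ → QBK ((∼ ∃' x Φ) ↔' ∀' x (∼ Φ))
      q5   : ∀ x Φ → QBK ((◇ ∃' x Φ) ⇒ ∃' x (◇ Φ))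
      mp   : ∀ {Φ Ψ} → QBK Φ → QBK (Φ ⇒ Ψ) → QBK Ψ
      mb   : ∀ {Φ Ψ} → QBK (Φ ⇒ Ψ) → QBK (□ Φ ⇒ □ Ψ)
      md   : ∀ {Φ Ψ} → QBK (Φ ⇒ Ψ) → QBK (◇ Φ ⇒ ◇ Ψ)
      br1  : ∀ {Φ Ψ} x → NotFree x Φ → QBK (Φ ⇒ Ψ) → QBK (Φ ⇒ ∀' x Ψ)
      br2  : ∀ {Φ Ψ} x → NotFree x Ψ → QBK (Φ ⇒ Ψ) → QBK (∃' x Φ ⇒ Ψ)

    data Deriv (Γ : Form C → Set) : Form C → Set where
      hyp : ∀ {Φ} → Γ Φ → Deriv Γ Φ
      ax  : ∀ {Φ} → QBK Φ → Deriv Γ Φ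
      mp  : ∀ {Φ Ψ} → Deriv Γ Φ → Deriv Γ (Φ ⇒ Ψ) → Deriv Γ Ψ
      br1 : ∀ {Φ Ψ} x → NotFree x Φ → Deriv Γ (Φ ⇒ Ψ) → Deriv Γ (Φ ⇒ ∀' x Ψ)
      br2 : ∀ {Φ Ψ} x → NotFree x Ψ → Deriv Γ (Φ ⇒ Ψ) → Deriv Γ (∃' x Φ ⇒ Ψ)

    disj : ℕ → Form C → Form C
    disj ℕ.zero Φ = ⊥'
    disj (ℕ.suc ℕ.zero) Φ = Φ
    disj (ℕ.suc (ℕ.suc n)) Φ = Φ ∨' disj (ℕ.suc n) Φ

    _⊢♯_ : (Form C → Set) → Form C → Set
    Γ ⊢♯ Φ = ∃[ n ] Deriv Γ (disj n Φ)

-- Worlds over σ⋆ = σ extended by constants s for s ∈ S⋆ = ℕ.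

module Worlds (σ : Signature) where
  open Signature σ
  open Syntax σ public

  Const⋆ : Set
  Const⋆ = Const ⊎ ℕ

  Form⋆ : Set
  Form⋆ = Form Const⋆

  Theory : Set₁
  Theory = Form⋆ → Set

  record Prime (Γ : Theory) : Set where
    field
      onlySentences : ∀ Φ → Γ Φ → Sentence Φ
      proper        : ∃[ Φ ] (Sentence Φ × ¬ Γ Φ)
      closed        : ∀ Φ → Sentence Φ → Γ ⊢♯ Φ → Γ Φ
      disjProp      : ∀ Φ Ψ → Γ (Φ ∨' Ψ) → Γ Φ ⊎ Γ Ψ

  record Saturated (Γ : Theory) : Set where
    field
      prime   : Prime Γ
      witness : ∀ x Φ → Γ (∃' x Φ) → ∃[ c ] Γ (Φ [ x / con c ])

  World : Set₁
  World = Σ Theory Saturated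

  _□⊆_ : Theory → Theory → Set
  Γ □⊆ Γ' = ∀ Φ → Γ (□ Φ) → Γ' Φ

-- Right to left, both parts hold because a prime theory decides every sentence (ax9), while md3
-- and md4 turn ¬ □ Φ and ¬ ◇ Φ into ◇ ¬ Φ and □ ¬ Φ. The content is the existence lemma. Given
-- ◇ Φ ∈ Γ, enumerate the σ⋆-sentences ψ₀, ψ₁, … (a prefix code plus excluded middle) and refine
-- Φ = δ₀ ⇐ δ₁ ⇐ … keeping ◇ δₙ ∈ Γ: δₙ₊₁ adds ψₙ whenever ◇ (δₙ ∧ ψₙ) ∈ Γ, and, if ψₙ = ∃ x χ,
-- also an instance χ(c), where c is supplied by the saturation of Γ applied to ∃ x ◇ (δₙ ∧ χ)
-- (axiom q5). Then Γ′ = {A | □ (δₙ ⇒ A) ∈ Γ for some n} contains Φ and (Γ)_□, decides every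
-- sentence, and is consistent since □ (δₙ ⇒ ⊥) contradicts ◇ δₙ; so Γ′ is a world.

module Submission where

open import Defs
open import Axiom.ExcludedMiddle using (ExcludedMiddle)
open import Level using (0ℓ)
open import Data.Nat using (ℕ; zero; suc; _≤_; _⊔_; _≡ᵇ_)
open import Data.Nat.Base using (_≤′_; ≤′-refl; ≤′-step)
open import Data.Nat.Properties using (≡ᵇ⇒≡; ≤⇒≤′; m≤m⊔n; m≤n⊔m)
open import Data.Nat.Binary using (ℕᵇ; 2[1+_]; 1+[2_]; toℕ)
open import Data.Nat.Binary.Properties using (toℕ-injective; 2[1+_]-injective; 1+[2_]-injective)
open import Data.Bool using (Bool; true; false; _∨_; _∧_; not)
open import Data.Bool.Properties using (∨-conicalˡ; ∨-conicalʳ; ∨-zeroʳ)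
open import Data.Vec using (Vec; []; _∷_)
open import Data.Unit using (⊤; tt)
open import Data.Empty using (⊥-elim)
open import Data.Sum using (_⊎_; inj₁; inj₂)
import Data.Sum as Sum
open import Data.Product using (Σ; _×_; _,_; proj₁; proj₂; ∃-syntax)
open import Relation.Nullary using (¬_; Dec; yes; no; contradiction)
open import Relation.Binary.PropositionalEquality using (_≡_; refl; cong; cong₂; trans; subst)
open import Function.Definitions using (Injective)
open import Function.Bundles using (_⇔_; mk⇔; Injection)

-- Prefix codes and enumerations

-- Injectivity in both arguments of prepend says that the code is prefix-free.
record PrefixCode (A : Set) : Set where
  field
    prepend           : A → ℕᵇ → ℕᵇ
    prepend-injective : ∀ {a b k l} → prepend a k ≡ prepend b l → a ≡ b × k ≡ l

  code : A → ℕ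
  code a = toℕ (prepend a ℕᵇ.zero)

  code-injective : Injective _≡_ _≡_ code
  code-injective eq = proj₁ (prepend-injective (toℕ-injective eq))

open PrefixCode

unary : ℕ → ℕᵇ → ℕᵇ
unary zero    k = 2[1+ k ]
unary (suc n) k = 1+[2 unary n k ]

unary-injective : ∀ m n {k l} → unary m k ≡ unary n l → m ≡ n × k ≡ l
unary-injective zero    zero    eq = refl , 2[1+_]-injective eq
unary-injective (suc m) (suc n) eq with unary-injective m n (1+[2_]-injective eq)
... | refl , k≡l = refl , k≡l

ℕ-code : PrefixCode ℕ
ℕ-code = record { prepend = unary ; prepend-injective = unary-injective _ _ }

comap : ∀ {A B} (f : A → B) → Injective _≡_ _≡_ f → PrefixCode B → PrefixCode A
comap f f-injective c = record
  { prepend           = λ a → prepend c (f a)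
  ; prepend-injective = λ eq → let fa≡fb , k≡l = prepend-injective c eq in f-injective fa≡fb , k≡l
  }

⊎-code : ∀ {A B} → PrefixCode A → PrefixCode B → PrefixCode (A ⊎ B)
⊎-code {A} {B} c d = record { prepend = write ; prepend-injective = write-injective _ _ }
  where
    write : A ⊎ B → ℕᵇ → ℕᵇ
    write (inj₁ a) k = 2[1+ prepend c a k ]
    write (inj₂ b) k = 1+[2 prepend d b k ]

    write-injective : ∀ x y {k l} → write x k ≡ write y l → x ≡ y × k ≡ l
    write-injective (inj₁ a) (inj₁ b) eq with prepend-injective c (2[1+_]-injective eq)
    ... | refl , k≡l = refl , k≡l
    write-injective (inj₂ a) (inj₂ b) eq with prepend-injective d (1+[2_]-injective eq)
    ... | refl , k≡l = refl , k≡l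

Vec-code : ∀ {A n} → PrefixCode A → PrefixCode (Vec A n)
Vec-code {A} c = record { prepend = write ; prepend-injective = write-injective _ _ }
  where
    write : ∀ {n} → Vec A n → ℕᵇ → ℕᵇ
    write []       k = k
    write (a ∷ as) k = prepend c a (write as k)

    write-injective : ∀ {n} (as bs : Vec A n) {k l} → write as k ≡ write bs l → as ≡ bs × k ≡ l
    write-injective []       []       eq = refl , eq
    write-injective (a ∷ as) (b ∷ bs) eq with prepend-injective c eq
    ... | refl , eq′ with write-injective as bs eq′
    ... | refl , k≡l = refl , k≡l

record Enumeration {A : Set} (P : A → Set) : Set where
  field
    at       : ℕ → A
    at-valid : ∀ n → P (at n)
    index    : ∀ a → P a → ∃[ n ] at n ≡ a

enumerate : ExcludedMiddle 0ℓ → ∀ {A} {P : A → Set} (f : A → ℕ) → Injective _≡_ _≡_ f →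
            ∀ {a₀} → P a₀ → Enumeration P
enumerate em {A} {P} f f-injective {a₀} Pa₀ = record
  { at       = λ n → proj₁ (choose n em)
  ; at-valid = λ n → proj₂ (choose n em)
  ; index    = λ a Pa → f a , chosen a Pa em
  }
  where
    Coded : ℕ → Set
    Coded n = ∃[ a ] P a × f a ≡ n

    choose : ∀ n → Dec (Coded n) → Σ A P
    choose n (yes (a , Pa , _)) = a , Pa
    choose n (no _)             = a₀ , Pa₀

    chosen : ∀ a → P a → (d : Dec (Coded (f a))) → proj₁ (choose (f a) d) ≡ a
    chosen a Pa (yes (b , _ , fb≡fa)) = f-injective fb≡fa
    chosen a Pa (no ¬coded)           = contradiction (a , Pa , refl) ¬coded

module _ (σ : Signature) where
  open Signature σ
  open Syntax σ

  Term-code : ∀ {C} → PrefixCode C → PrefixCode (Term C)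
  Term-code {C} c = comap split split-injective (⊎-code ℕ-code c)
    where
      split : Term C → ℕ ⊎ C
      split (var x) = inj₁ x
      split (con a) = inj₂ a

      split-injective : Injective _≡_ _≡_ split
      split-injective {var _} {var _} refl = refl
      split-injective {con _} {con _} refl = refl

  Form-code : ∀ {C} → PrefixCode Pred → PrefixCode C → PrefixCode (Form C)
  Form-code {C} p c = record { prepend = write ; prepend-injective = write-injective _ _ }
    where
      terms : ∀ {n} → PrefixCode (Vec (Term C) n)
      terms = Vec-code (Term-code c)

      write : Form C → ℕᵇ → ℕᵇ
      write (atom q ts) k = unary 0 (prepend p q (prepend terms ts k))
      write ⊥'          k = unary 1 k
      write (A ⇒ B)     k = unary 2 (write A (write B k))
      write (A ∧' B)    k = unary 3 (write A (write B k))
      write (A ∨' B)    k = unary 4 (write A (write B k))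
      write (∼ A)       k = unary 5 (write A k)
      write (□ A)       k = unary 6 (write A k)
      write (◇ A)       k = unary 7 (write A k)
      write (∀' x A)    k = unary 8 (unary x (write A k))
      write (∃' x A)    k = unary 9 (unary x (write A k))

      untag : ∀ n {k l} → unary n k ≡ unary n l → k ≡ l
      untag n eq = proj₂ (unary-injective n n eq)

      write-injective : ∀ A B {k l} → write A k ≡ write B l → A ≡ B × k ≡ l
      write₂-injective : ∀ A B A′ B′ {k l} → write A (write B k) ≡ write A′ (write B′ l) →
                         A ≡ A′ × B ≡ B′ × k ≡ l

      write-injective (atom q ts) (atom r us) eq with prepend-injective p {q} {r} (untag 0 eq)
      ... | refl , eq′ with prepend-injective terms {ts} {us} eq′
      ... | refl , k≡l = refl , k≡l
      write-injective ⊥' ⊥' eq = refl , proj₂ (unary-injective 1 1 eq)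
      write-injective (A ⇒ B) (A′ ⇒ B′) eq with write₂-injective A B A′ B′ (untag 2 eq)
      ... | refl , refl , k≡l = refl , k≡l
      write-injective (A ∧' B) (A′ ∧' B′) eq with write₂-injective A B A′ B′ (untag 3 eq)
      ... | refl , refl , k≡l = refl , k≡l
      write-injective (A ∨' B) (A′ ∨' B′) eq with write₂-injective A B A′ B′ (untag 4 eq)
      ... | refl , refl , k≡l = refl , k≡l
      write-injective (∼ A) (∼ A′) eq with write-injective A A′ (untag 5 eq)
      ... | refl , k≡l = refl , k≡l
      write-injective (□ A) (□ A′) eq with write-injective A A′ (untag 6 eq)
      ... | refl , k≡l = refl , k≡l
      write-injective (◇ A) (◇ A′) eq with write-injective A A′ (untag 7 eq)
      ... | refl , k≡l = refl , k≡l
      write-injective (∀' x A) (∀' y A′) eq with unary-injective x y (untag 8 eq)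
      ... | refl , eq′ with write-injective A A′ eq′
      ... | refl , k≡l = refl , k≡l
      write-injective (∃' x A) (∃' y A′) eq with unary-injective x y (untag 9 eq)
      ... | refl , eq′ with write-injective A A′ eq′
      ... | refl , k≡l = refl , k≡l

      write₂-injective A B A′ B′ eq with write-injective A A′ eq
      ... | refl , eq′ with write-injective B B′ eq′
      ... | refl , k≡l = refl , refl , k≡l

-- Substitution and free variables

≡ᵇ-refl : ∀ x → (x ≡ᵇ x) ≡ true
≡ᵇ-refl zero    = refl
≡ᵇ-refl (suc x) = ≡ᵇ-refl x

≡ᵇ-sym : ∀ x y → (x ≡ᵇ y) ≡ (y ≡ᵇ x)
≡ᵇ-sym zero    zero    = refl
≡ᵇ-sym zero    (suc y) = refl
≡ᵇ-sym (suc x) zero    = refl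
≡ᵇ-sym (suc x) (suc y) = ≡ᵇ-sym x y

-- Stated pointwise because Sentence is not injective: here the formulas are inferred by
-- higher-order pattern unification, e.g. for Sentence (A ⇒ B).
sentence₂ : ∀ {a b : ℕ → Bool} → (∀ x → a x ≡ false) → (∀ x → b x ≡ false) → ∀ x → a x ∨ b x ≡ false
sentence₂ sA sB x = cong₂ _∨_ (sA x) (sB x)

sentence₂ˡ : ∀ {a b : ℕ → Bool} → (∀ x → a x ∨ b x ≡ false) → ∀ x → a x ≡ false
sentence₂ˡ s x = ∨-conicalˡ _ _ (s x)

sentence₂ʳ : ∀ {a b : ℕ → Bool} → (∀ x → a x ∨ b x ≡ false) → ∀ x → b x ≡ false
sentence₂ʳ s x = ∨-conicalʳ _ _ (s x)

module SyntaxFacts (σ : Signature) where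
  open Syntax σ

  module _ {C : Set} where

    NotFree-∃ : ∀ x (A : Form C) → NotFree x (∃' x A)
    NotFree-∃ x A = cong (λ b → not b ∧ occursFree x A) (≡ᵇ-refl x)

    [/]-NotFree : ∀ {x} t (A : Form C) → NotFree x A → A [ x / t ] ≡ A
    [/]-NotFree t (atom p ts) nf = cong (atom p) (terms ts nf)
      where
        term : ∀ {x} (s : Term C) → termHasVar x s ≡ false → substT x t s ≡ s
        term (var y) nf rewrite nf = refl
        term (con c) nf = refl

        terms : ∀ {x n} (ss : Vec (Term C) n) → anyTerm x ss ≡ false → substTs x t ss ≡ ss
        terms []       nf = refl
        terms (s ∷ ss) nf = cong₂ _∷_ (term s (∨-conicalˡ _ _ nf)) (terms ss (∨-conicalʳ _ _ nf))
    [/]-NotFree t ⊥'       nf = refl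
    [/]-NotFree t (A ⇒ B)  nf = cong₂ _⇒_ ([/]-NotFree t A (∨-conicalˡ _ _ nf)) ([/]-NotFree t B (∨-conicalʳ _ _ nf))
    [/]-NotFree t (A ∧' B) nf = cong₂ _∧'_ ([/]-NotFree t A (∨-conicalˡ _ _ nf)) ([/]-NotFree t B (∨-conicalʳ _ _ nf))
    [/]-NotFree t (A ∨' B) nf = cong₂ _∨'_ ([/]-NotFree t A (∨-conicalˡ _ _ nf)) ([/]-NotFree t B (∨-conicalʳ _ _ nf))
    [/]-NotFree t (∼ A)    nf = cong ∼_ ([/]-NotFree t A nf)
    [/]-NotFree t (□ A)    nf = cong □_ ([/]-NotFree t A nf)
    [/]-NotFree t (◇ A)    nf = cong ◇_ ([/]-NotFree t A nf)
    [/]-NotFree {x} t (∀' y A) nf with x ≡ᵇ y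
    ... | true  = refl
    ... | false = cong (∀' y) ([/]-NotFree t A nf)
    [/]-NotFree {x} t (∃' y A) nf with x ≡ᵇ y
    ... | true  = refl
    ... | false = cong (∃' y) ([/]-NotFree t A nf)

    [/]-self : ∀ x (A : Form C) → A [ x / var x ] ≡ A
    [/]-self x (atom p ts) = cong (atom p) (terms ts)
      where
        term : (s : Term C) → substT x (var x) s ≡ s
        term (var y) with x ≡ᵇ y | ≡ᵇ⇒≡ x y
        ... | true  | x≡y = cong var (x≡y _)
        ... | false | _   = refl
        term (con c) = refl

        terms : ∀ {n} (ss : Vec (Term C) n) → substTs x (var x) ss ≡ ss
        terms []       = refl
        terms (s ∷ ss) = cong₂ _∷_ (term s) (terms ss)
    [/]-self x ⊥'       = refl
    [/]-self x (A ⇒ B)  = cong₂ _⇒_ ([/]-self x A) ([/]-self x B)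
    [/]-self x (A ∧' B) = cong₂ _∧'_ ([/]-self x A) ([/]-self x B)
    [/]-self x (A ∨' B) = cong₂ _∨'_ ([/]-self x A) ([/]-self x B)
    [/]-self x (∼ A)    = cong ∼_ ([/]-self x A)
    [/]-self x (□ A)    = cong □_ ([/]-self x A)
    [/]-self x (◇ A)    = cong ◇_ ([/]-self x A)
    [/]-self x (∀' y A) with x ≡ᵇ y
    ... | true  = refl
    ... | false = cong (∀' y) ([/]-self x A)
    [/]-self x (∃' y A) with x ≡ᵇ y
    ... | true  = refl
    ... | false = cong (∃' y) ([/]-self x A)

    con-FreeFor : ∀ c x (A : Form C) → FreeFor (con c) x A
    con-FreeFor c x (atom p ts) = refl
    con-FreeFor c x ⊥'          = refl
    con-FreeFor c x (A ⇒ B)     = cong₂ _∧_ (con-FreeFor c x A) (con-FreeFor c x B)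
    con-FreeFor c x (A ∧' B)    = cong₂ _∧_ (con-FreeFor c x A) (con-FreeFor c x B)
    con-FreeFor c x (A ∨' B)    = cong₂ _∧_ (con-FreeFor c x A) (con-FreeFor c x B)
    con-FreeFor c x (∼ A)       = con-FreeFor c x A
    con-FreeFor c x (□ A)       = con-FreeFor c x A
    con-FreeFor c x (◇ A)       = con-FreeFor c x A
    con-FreeFor c x (∀' y A)    = trans (cong (not (occursFree x (∀' y A)) ∨_) (con-FreeFor c x A)) (∨-zeroʳ _)
    con-FreeFor c x (∃' y A)    = trans (cong (not (occursFree x (∃' y A)) ∨_) (con-FreeFor c x A)) (∨-zeroʳ _)

    var-FreeFor : ∀ x (A : Form C) → FreeFor (var x) x A
    var-FreeFor x (atom p ts) = refl
    var-FreeFor x ⊥'          = refl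
    var-FreeFor x (A ⇒ B)     = cong₂ _∧_ (var-FreeFor x A) (var-FreeFor x B)
    var-FreeFor x (A ∧' B)    = cong₂ _∧_ (var-FreeFor x A) (var-FreeFor x B)
    var-FreeFor x (A ∨' B)    = cong₂ _∧_ (var-FreeFor x A) (var-FreeFor x B)
    var-FreeFor x (∼ A)       = var-FreeFor x A
    var-FreeFor x (□ A)       = var-FreeFor x A
    var-FreeFor x (◇ A)       = var-FreeFor x A
    var-FreeFor x (∀' y A) rewrite ≡ᵇ-sym y x with x ≡ᵇ y
    ... | true  = refl
    ... | false = trans (cong (not (occursFree x A) ∨_) (var-FreeFor x A)) (∨-zeroʳ _)
    var-FreeFor x (∃' y A) rewrite ≡ᵇ-sym y x with x ≡ᵇ y
    ... | true  = refl
    ... | false = trans (cong (not (occursFree x A) ∨_) (var-FreeFor x A)) (∨-zeroʳ _)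

-- Hilbert-style deduction

module Deduction (σ : Signature) {C : Set} where
  open Syntax σ

  infixl 4 _,,_
  data Ctx : Set where
    ε    : Ctx
    _,,_ : Ctx → Form C → Ctx

  _⇛_ : Ctx → Form C → Form C
  ε        ⇛ A = A
  (Δ ,, B) ⇛ A = Δ ⇛ (B ⇒ A)

  -- Δ ⊩ A is the theorem Δ ⇛ A; the deduction theorem (bracket abstraction into ax1 and ax2)
  -- is built into the combinators below, so derivations can be written as λ-terms.
  record _⊩_ (Δ : Ctx) (A : Form C) : Set where
    constructor ⟨_⟩
    field theorem : QBK (Δ ⇛ A)
  open _⊩_ public

  ⇒-refl : ∀ (A : Form C) → QBK (A ⇒ A)
  ⇒-refl A = mp (ax1 A A) (mp (ax1 A (A ⇒ A)) (ax2 A (A ⇒ A) A))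

  private
    weaken* : ∀ Δ {A} → QBK A → QBK (Δ ⇛ A)
    weaken* ε        a = a
    weaken* (Δ ,, B) a = weaken* Δ (mp a (ax1 _ B))

    mp* : ∀ Δ {A B} → QBK (Δ ⇛ (A ⇒ B)) → QBK (Δ ⇛ A) → QBK (Δ ⇛ B)
    mp* ε        f a = mp a f
    mp* (Δ ,, D) f a = mp* Δ (mp* Δ (weaken* Δ (ax2 D _ _)) f) a

  thm : ∀ {Δ A} → QBK A → Δ ⊩ A
  thm {Δ} a = ⟨ weaken* Δ a ⟩

  infixl 5 _·_
  _·_ : ∀ {Δ A B} → Δ ⊩ (A ⇒ B) → Δ ⊩ A → Δ ⊩ B
  _·_ {Δ} f a = ⟨ mp* Δ (theorem f) (theorem a) ⟩

  ƛ : ∀ {Δ A B} → (Δ ,, A) ⊩ B → Δ ⊩ (A ⇒ B)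
  ƛ d = ⟨ theorem d ⟩

  v₀ : ∀ {Δ A} → (Δ ,, A) ⊩ A
  v₀ {Δ} {A} = ⟨ theorem {Δ} (thm (⇒-refl A)) ⟩

  wk : ∀ {Δ A B} → Δ ⊩ A → (Δ ,, B) ⊩ A
  wk {Δ} d = ⟨ theorem {Δ} (thm (ax1 _ _) · d) ⟩

  v₁ : ∀ {Δ A B} → (Δ ,, A ,, B) ⊩ A
  v₁ = wk v₀

  v₂ : ∀ {Δ A B D} → (Δ ,, A ,, B ,, D) ⊩ A
  v₂ = wk v₁

  ∧-intro : ∀ {Δ A B} → Δ ⊩ A → Δ ⊩ B → Δ ⊩ (A ∧' B)
  ∧-intro a b = thm (ax5 _ _) · a · b

  ∧-elimˡ : ∀ {Δ A B} → Δ ⊩ (A ∧' B) → Δ ⊩ A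
  ∧-elimˡ d = thm (ax3 _ _) · d

  ∧-elimʳ : ∀ {Δ A B} → Δ ⊩ (A ∧' B) → Δ ⊩ B
  ∧-elimʳ d = thm (ax4 _ _) · d

  proof : ∀ {A} → ε ⊩ A → QBK A
  proof = theorem

  ⇒-trans : ∀ {A B C} → QBK (A ⇒ B) → QBK (B ⇒ C) → QBK (A ⇒ C)
  ⇒-trans f g = proof (ƛ (thm g · (thm f · v₀)))

  ⇒-curry : ∀ {A B C} → QBK ((A ∧' B) ⇒ C) → QBK (A ⇒ (B ⇒ C))
  ⇒-curry f = proof (ƛ (ƛ (thm f · ∧-intro v₁ v₀)))

  ⇒-uncurry : ∀ {A B C} → QBK (A ⇒ (B ⇒ C)) → QBK ((A ∧' B) ⇒ C)
  ⇒-uncurry f = proof (ƛ (thm f · ∧-elimˡ v₀ · ∧-elimʳ v₀))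

  ⇒-flip : ∀ {A B C} → QBK (A ⇒ (B ⇒ C)) → QBK (B ⇒ (A ⇒ C))
  ⇒-flip f = proof (ƛ (ƛ (thm f · v₀ · v₁)))

  disj⇒ : ∀ n (A : Form C) → QBK (disj n A ⇒ A)
  disj⇒ zero          A = ax10 A
  disj⇒ (suc zero)    A = ⇒-refl A
  disj⇒ (suc (suc n)) A = mp (disj⇒ (suc n) A) (mp (⇒-refl A) (ax8 A (disj (suc n) A) A))

module QuantifierFacts (σ : Signature) {C : Set} where
  open Syntax σ
  open SyntaxFacts σ
  open Deduction σ

  ∧-∃-distrib : ∀ {x} {δ χ : Form C} → NotFree x δ → QBK ((δ ∧' ∃' x χ) ⇒ ∃' x (δ ∧' χ))
  ∧-∃-distrib {x} {δ} {χ} nf = ⇒-uncurry (⇒-flip (br2 x nf′ (⇒-flip (⇒-curry δ∧χ⇒∃))))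
    where
      δ∧χ⇒∃ : QBK ((δ ∧' χ) ⇒ ∃' x (δ ∧' χ))
      δ∧χ⇒∃ = subst (λ A → QBK (A ⇒ ∃' x (δ ∧' χ))) ([/]-self x (δ ∧' χ))
                (q2 x (δ ∧' χ) (var x) (var-FreeFor x (δ ∧' χ)))

      nf′ : NotFree x (δ ⇒ ∃' x (δ ∧' χ))
      nf′ = cong₂ _∨_ nf (NotFree-∃ x (δ ∧' χ))

-- Theories closed under derivation

module Compactness (σ : Signature) {C : Set} {T : Syntax.Form σ C → Set} where
  open Syntax σ
  open Deduction σ

  module _ (T-sentence : ∀ {A} → T A → Sentence A) (T-∧ : ∀ {A B} → T A → T B → T (A ∧' B))
           {θ₀ : Form C} (θ₀∈T : T θ₀) where

    Deriv-compact : ∀ {A} → Deriv T A → ∃[ θ ] T θ × QBK (θ ⇒ A)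
    Deriv-compact (hyp A∈T) = _ , A∈T , ⇒-refl _
    Deriv-compact (ax a)    = θ₀ , θ₀∈T , mp a (ax1 _ θ₀)
    Deriv-compact (mp dA dA⇒B) with Deriv-compact dA | Deriv-compact dA⇒B
    ... | θ , θ∈T , θ⇒A | θ′ , θ′∈T , θ′⇒A⇒B =
      θ ∧' θ′ , T-∧ θ∈T θ′∈T , proof (ƛ (thm θ′⇒A⇒B · ∧-elimʳ v₀ · (thm θ⇒A · ∧-elimˡ v₀)))
    Deriv-compact (br1 {A} x nf d) with Deriv-compact d
    ... | θ , θ∈T , θ⇒A⇒B =
      θ , θ∈T , ⇒-curry (br1 x (trans (cong (_∨ occursFree x A) (T-sentence θ∈T x)) nf) (⇒-uncurry θ⇒A⇒B))
    Deriv-compact (br2 {Ψ = B} x nf d) with Deriv-compact d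
    ... | θ , θ∈T , θ⇒A⇒B =
      θ , θ∈T , ⇒-flip (br2 x (trans (cong (_∨ occursFree x B) (T-sentence θ∈T x)) nf) (⇒-flip θ⇒A⇒B))

    ⊢♯-closed : (∀ {A B} → T A → QBK (A ⇒ B) → Sentence B → T B) → ∀ {A} → Sentence A → T ⊢♯ A → T A
    ⊢♯-closed T-mp {A} sA (n , d) =
      let θ , θ∈T , θ⇒A∨…∨A = Deriv-compact d in T-mp θ∈T (⇒-trans θ⇒A∨…∨A (disj⇒ n A)) sA

module PrimeTheory (σ : Signature) {Γ : Worlds.Theory σ} (prime : Worlds.Prime σ Γ) where
  open Worlds σ
  open SyntaxFacts σ
  open Deduction σ
  open Prime prime

  ∈-sentence : ∀ {A} → Γ A → Sentence A
  ∈-sentence = onlySentences _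

  ∈-theorem : ∀ {A} → QBK A → Sentence A → Γ A
  ∈-theorem a sA = closed _ sA (1 , ax a)

  ∈-mp : ∀ {A B} → Γ A → QBK (A ⇒ B) → Sentence B → Γ B
  ∈-mp A∈Γ f sB = closed _ sB (1 , mp (hyp A∈Γ) (ax f))

  ∈-mp₂ : ∀ {A B C} → Γ A → Γ B → QBK (A ⇒ B ⇒ C) → Sentence C → Γ C
  ∈-mp₂ A∈Γ B∈Γ f sC = closed _ sC (1 , mp (hyp B∈Γ) (mp (hyp A∈Γ) (ax f)))

  ⊥∉ : ¬ Γ ⊥'
  ⊥∉ ⊥∈Γ = let Ψ , sΨ , Ψ∉Γ = proper in Ψ∉Γ (∈-mp ⊥∈Γ (ax10 Ψ) sΨ)

  ∈-¬-contradiction : ∀ {A} → Γ A → ¬ Γ (¬' A)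
  ∈-¬-contradiction A∈Γ ¬A∈Γ = ⊥∉ (∈-mp₂ A∈Γ ¬A∈Γ (proof (ƛ (ƛ (v₀ · v₁)))) (λ _ → refl))

  ∈-or-¬∈ : ∀ {A} → Sentence A → Γ A ⊎ Γ (¬' A)
  ∈-or-¬∈ {A} sA = disjProp A (¬' A) (∈-theorem (ax9 A) (sentence₂ sA (sentence₂ sA (λ _ → refl))))

  ∈-by-contradiction : ∀ {A} → Sentence A → ¬ Γ (¬' A) → Γ A
  ∈-by-contradiction sA ¬A∉Γ with ∈-or-¬∈ sA
  ... | inj₁ A∈Γ  = A∈Γ
  ... | inj₂ ¬A∈Γ = ⊥-elim (¬A∉Γ ¬A∈Γ)

  ¬◇⇒□¬ : ∀ {A} → Γ (¬' (◇ A)) → Γ (□ (¬' A))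
  ¬◇⇒□¬ ¬◇A∈Γ = ∈-mp ¬◇A∈Γ (mp (md4 _) (ax3 _ _)) (sentence₂ (sentence₂ˡ (∈-sentence ¬◇A∈Γ)) (λ _ → refl))

  □¬⇒¬◇ : ∀ {A} → Γ (□ (¬' A)) → Γ (¬' (◇ A))
  □¬⇒¬◇ □¬A∈Γ = ∈-mp □¬A∈Γ (mp (md4 _) (ax4 _ _)) (sentence₂ (sentence₂ˡ (∈-sentence □¬A∈Γ)) (λ _ → refl))

  ¬□⇒◇¬ : ∀ {A} → Γ (¬' (□ A)) → Γ (◇ (¬' A))
  ¬□⇒◇¬ ¬□A∈Γ = ∈-mp ¬□A∈Γ (mp (md3 _) (ax3 _ _)) (sentence₂ (sentence₂ˡ (∈-sentence ¬□A∈Γ)) (λ _ → refl))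

  □-theorem : ∀ {A} → QBK A → Sentence A → Γ (□ A)
  □-theorem a sA = ∈-mp (∈-theorem (md2 ⊥') (λ _ → refl)) (mb (mp a (ax1 _ _))) sA

  □-mp : ∀ {A B} → Γ (□ A) → QBK (A ⇒ B) → Sentence B → Γ (□ B)
  □-mp □A∈Γ f sB = ∈-mp □A∈Γ (mb f) sB

  □-mp₂ : ∀ {A B C} → Γ (□ A) → Γ (□ B) → QBK (A ⇒ B ⇒ C) → Sentence C → Γ (□ C)
  □-mp₂ □A∈Γ □B∈Γ f sC =
    □-mp (∈-mp₂ □A∈Γ □B∈Γ (⇒-curry (md1 _ _)) (sentence₂ (∈-sentence □A∈Γ) (∈-sentence □B∈Γ))) (⇒-uncurry f) sC

-- The existence lemma

module ExistenceLemma (em : ExcludedMiddle 0ℓ) (σ : Signature) (countable : Countable σ) where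
  open Worlds σ
  open SyntaxFacts σ
  open Deduction σ
  open QuantifierFacts σ
  open Countable countable
  open PrefixCode

  Form⋆-code : PrefixCode Form⋆
  Form⋆-code = Form-code σ (comap (Injection.to predInj) (Injection.injective predInj) ℕ-code)
                           (⊎-code (comap (Injection.to constInj) (Injection.injective constInj) ℕ-code) ℕ-code)

  open Enumeration (enumerate em {P = Sentence} (code Form⋆-code) (code-injective Form⋆-code) {⊥'} (λ _ → refl))
    renaming (at to ψ; at-valid to ψ-sentence)

  module _ {Γ : Theory} (Γ-saturated : Saturated Γ) {Φ : Form⋆} (◇Φ∈Γ : Γ (◇ Φ)) where
    open Saturated Γ-saturated
    open PrimeTheory σ prime

    Witness : Form⋆ → Form⋆ → Set
    Witness δ (∃' x χ) = ∃[ c ] Sentence (χ [ x / con c ]) × QBK (δ ⇒ χ [ x / con c ])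
    Witness δ _        = ⊤

    Accepts : Form⋆ → Form⋆ → Set
    Accepts δ A = QBK (δ ⇒ A) × Witness δ A

    record Step (δ A : Form⋆) : Set where
      field
        δ′       : Form⋆
        possible : Γ (◇ δ′)
        δ′⇒δ     : QBK (δ′ ⇒ δ)
        decided  : Accepts δ′ A ⊎ Γ (¬' (◇ (δ ∧' A)))

    accept : ∀ {δ A} → Γ (◇ (δ ∧' A)) → Witness (δ ∧' A) A → Step δ A
    accept ◇δ∧A w = record { δ′ = _ ; possible = ◇δ∧A ; δ′⇒δ = ax3 _ _ ; decided = inj₁ (ax4 _ _ , w) }

    ◇∃-witness : ∀ {δ x χ} → Γ (◇ (δ ∧' ∃' x χ)) → ∃[ c ] Γ (◇ (δ ∧' χ [ x / con c ]))
    ◇∃-witness {δ} {x} {χ} ◇δ∧∃ =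
      let c , ◇δ∧χ[c] = witness x (◇ (δ ∧' χ))
                          (∈-mp ◇δ∧∃ (⇒-trans (md (∧-∃-distrib (sδ x))) (q5 x (δ ∧' χ))) s∃◇)
      in c , subst (λ δ′ → Γ (◇ (δ′ ∧' χ [ x / con c ]))) ([/]-NotFree (con c) δ (sδ x)) ◇δ∧χ[c]
      where
        sδ : Sentence δ
        sδ = sentence₂ˡ (∈-sentence ◇δ∧∃)

        s∃ : Sentence (∃' x χ)
        s∃ = sentence₂ʳ (∈-sentence ◇δ∧∃)

        s∃◇ : Sentence (∃' x (◇ (δ ∧' χ)))
        s∃◇ y = trans (cong (λ b → not (y ≡ᵇ x) ∧ (b ∨ occursFree y χ)) (sδ y)) (s∃ y)

    accept-∃ : ∀ {δ x χ} → Γ (◇ (δ ∧' ∃' x χ)) → Step δ (∃' x χ)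
    accept-∃ {δ} {x} {χ} ◇δ∧∃ = record
      { δ′       = δ ∧' χ [ x / con c ]
      ; possible = ◇δ∧χ[c]
      ; δ′⇒δ     = ax3 _ _
      ; decided  = inj₁ (⇒-trans (ax4 _ _) (q2 x χ (con c) (con-FreeFor c x χ)) ,
                         c , sentence₂ʳ (∈-sentence ◇δ∧χ[c]) , ax4 _ _)
      }
      where
        c = proj₁ (◇∃-witness ◇δ∧∃)
        ◇δ∧χ[c] = proj₂ (◇∃-witness ◇δ∧∃)

    -- Witness reduces to ⊤ only on constructor-headed formulas, hence the split on A.
    step : ∀ {δ A} → Γ (◇ δ) → Sentence A → Step δ A
    step {δ} {A} ◇δ sA with ∈-or-¬∈ (sentence₂ (∈-sentence ◇δ) sA)
    ... | inj₂ ¬◇δ∧A = record { δ′ = δ ; possible = ◇δ ; δ′⇒δ = ⇒-refl δ ; decided = inj₂ ¬◇δ∧A }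
    ... | inj₁ ◇δ∧A with A
    ... | atom p ts = accept ◇δ∧A tt
    ... | ⊥'       = accept ◇δ∧A tt
    ... | _ ⇒ _    = accept ◇δ∧A tt
    ... | _ ∧' _   = accept ◇δ∧A tt
    ... | _ ∨' _   = accept ◇δ∧A tt
    ... | ∼ _      = accept ◇δ∧A tt
    ... | □ _      = accept ◇δ∧A tt
    ... | ◇ _      = accept ◇δ∧A tt
    ... | ∀' _ _   = accept ◇δ∧A tt
    ... | ∃' _ _   = accept-∃ ◇δ∧A

    chain : ℕ → Σ Form⋆ (λ δ → Γ (◇ δ))
    chain zero    = Φ , ◇Φ∈Γ
    chain (suc n) = let s = step {A = ψ n} (proj₂ (chain n)) (ψ-sentence n) in Step.δ′ s , Step.possible s

    δ : ℕ → Form⋆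
    δ n = proj₁ (chain n)

    ◇δ∈Γ : ∀ n → Γ (◇ (δ n))
    ◇δ∈Γ n = proj₂ (chain n)

    δ-sentence : ∀ n → Sentence (δ n)
    δ-sentence n = ∈-sentence (◇δ∈Γ n)

    step-at : ∀ n → Step (δ n) (ψ n)
    step-at n = step {A = ψ n} (◇δ∈Γ n) (ψ-sentence n)

    δ-antitone : ∀ {m n} → m ≤ n → QBK (δ n ⇒ δ m)
    δ-antitone m≤n = go (≤⇒≤′ m≤n)
      where
        go : ∀ {m n} → m ≤′ n → QBK (δ n ⇒ δ m)
        go ≤′-refl       = ⇒-refl _
        go (≤′-step m≤n) = ⇒-trans (Step.δ′⇒δ (step-at _)) (go m≤n)

    Γ′ : Theory
    Γ′ A = ∃[ n ] Γ (□ (δ n ⇒ A))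

    Γ′-sentence : ∀ {A} → Γ′ A → Sentence A
    Γ′-sentence (_ , □δ⇒A) = sentence₂ʳ (∈-sentence □δ⇒A)

    □δ⇒-mono : ∀ {m n A} → m ≤ n → Γ (□ (δ m ⇒ A)) → Γ (□ (δ n ⇒ A))
    □δ⇒-mono {n = n} m≤n □δ⇒A =
      □-mp □δ⇒A (proof (ƛ (ƛ (v₁ · (thm (δ-antitone m≤n) · v₀)))))
           (sentence₂ (δ-sentence n) (sentence₂ʳ (∈-sentence □δ⇒A)))

    Γ′-mp₂ : ∀ {A B C} → Γ′ A → Γ′ B → QBK (A ⇒ B ⇒ C) → Sentence C → Γ′ C
    Γ′-mp₂ (m , □δ⇒A) (n , □δ⇒B) f sC =
      m ⊔ n , □-mp₂ (□δ⇒-mono (m≤m⊔n m n) □δ⇒A) (□δ⇒-mono (m≤n⊔m m n) □δ⇒B)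
                    (proof (ƛ (ƛ (ƛ (thm f · (v₂ · v₀) · (v₁ · v₀)))))) (sentence₂ (δ-sentence (m ⊔ n)) sC)

    Γ′-mp : ∀ {A B} → Γ′ A → QBK (A ⇒ B) → Sentence B → Γ′ B
    Γ′-mp (n , □δ⇒A) f sB = n , □-mp □δ⇒A (proof (ƛ (ƛ (thm f · (v₁ · v₀))))) (sentence₂ (δ-sentence n) sB)

    Γ′-∧ : ∀ {A B} → Γ′ A → Γ′ B → Γ′ (A ∧' B)
    Γ′-∧ A∈Γ′ B∈Γ′ = Γ′-mp₂ A∈Γ′ B∈Γ′ (ax5 _ _) (sentence₂ (Γ′-sentence A∈Γ′) (Γ′-sentence B∈Γ′))

    Φ∈Γ′ : Γ′ Φ
    Φ∈Γ′ = 0 , ∈-theorem (md2 Φ) (sentence₂ (δ-sentence 0) (δ-sentence 0))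

    □⊆Γ′ : Γ □⊆ Γ′
    □⊆Γ′ A □A∈Γ = 0 , □-mp □A∈Γ (ax1 A Φ) (sentence₂ (δ-sentence 0) (∈-sentence □A∈Γ))

    ⊥∉Γ′ : ¬ Γ′ ⊥'
    ⊥∉Γ′ (n , □¬δ) = ∈-¬-contradiction (◇δ∈Γ n) (□¬⇒¬◇ □¬δ)

    Γ′-consistent : ∀ {A} → Γ′ A → ¬ Γ′ (¬' A)
    Γ′-consistent A∈Γ′ ¬A∈Γ′ = ⊥∉Γ′ (Γ′-mp₂ A∈Γ′ ¬A∈Γ′ (proof (ƛ (ƛ (v₀ · v₁)))) (λ _ → refl))

    accepted∈Γ′ : ∀ n {A} → QBK (δ n ⇒ A) → Sentence A → Γ′ A
    accepted∈Γ′ n δ⇒A sA = n , □-theorem δ⇒A (sentence₂ (δ-sentence n) sA)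

    rejected∈Γ′ : ∀ n {A} → Γ (¬' (◇ (δ n ∧' A))) → Sentence A → Γ′ (¬' A)
    rejected∈Γ′ n ¬◇δ∧A sA =
      n , □-mp (¬◇⇒□¬ ¬◇δ∧A) (proof (ƛ (ƛ (ƛ (v₂ · ∧-intro v₁ v₀)))))
               (sentence₂ (δ-sentence n) (sentence₂ sA (λ _ → refl)))

    decided : ∀ {A} → Sentence A → (∃[ n ] Accepts (δ (suc n)) A) ⊎ Γ′ (¬' A)
    decided {A} sA with index A sA
    ... | n , refl = Sum.map (n ,_) (λ ¬◇δ∧A → rejected∈Γ′ n ¬◇δ∧A sA) (Step.decided (step-at n))

    Γ′-complete : ∀ {A} → Sentence A → Γ′ A ⊎ Γ′ (¬' A)
    Γ′-complete sA = Sum.map₁ (λ (n , δ⇒A , _) → accepted∈Γ′ (suc n) δ⇒A sA) (decided sA)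

    Γ′-disjunction : ∀ {A B} → Γ′ (A ∨' B) → Γ′ A ⊎ Γ′ B
    Γ′-disjunction {A} {B} A∨B∈Γ′
      with Γ′-complete {A} (sentence₂ˡ (Γ′-sentence A∨B∈Γ′)) | Γ′-complete {B} (sentence₂ʳ (Γ′-sentence A∨B∈Γ′))
    ... | inj₁ A∈Γ′ | _         = inj₁ A∈Γ′
    ... | inj₂ _    | inj₁ B∈Γ′ = inj₂ B∈Γ′
    ... | inj₂ ¬A   | inj₂ ¬B   =
      ⊥-elim (Γ′-consistent A∨B∈Γ′ (Γ′-mp₂ ¬A ¬B (ax8 A B ⊥') (sentence₂ (Γ′-sentence A∨B∈Γ′) (λ _ → refl))))

    Γ′-witness : ∀ x χ → Γ′ (∃' x χ) → ∃[ c ] Γ′ (χ [ x / con c ])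
    Γ′-witness x χ ∃∈Γ′ with decided {∃' x χ} (Γ′-sentence ∃∈Γ′)
    ... | inj₁ (n , _ , c , sχ[c] , δ⇒χ[c]) = c , accepted∈Γ′ (suc n) δ⇒χ[c] sχ[c]
    ... | inj₂ ¬∃∈Γ′                         = ⊥-elim (Γ′-consistent ∃∈Γ′ ¬∃∈Γ′)

    Γ′-saturated : Saturated Γ′
    Γ′-saturated = record
      { prime = record
        { onlySentences = λ _ → Γ′-sentence
        ; proper        = ⊥' , (λ _ → refl) , ⊥∉Γ′
        ; closed        = λ _ sA → Compactness.⊢♯-closed σ Γ′-sentence Γ′-∧ Φ∈Γ′ Γ′-mp sA
        ; disjProp      = λ _ _ → Γ′-disjunction
        }
      ; witness = Γ′-witness
      }

    existence : Σ World λ Δ → proj₁ Δ Φ × Γ □⊆ proj₁ Δ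
    existence = (Γ′ , Γ′-saturated) , Φ∈Γ′ , □⊆Γ′

lemma20 : ExcludedMiddle 0ℓ → (σ : Signature) → Countable σ →
    let open Worlds σ in
    (Γ : World) (Φ : Form⋆) → Sentence Φ →
      (proj₁ Γ (◇ Φ) ⇔ (Σ World λ Γ' → (proj₁ Γ' Φ × (proj₁ Γ □⊆ proj₁ Γ'))))
      × (proj₁ Γ (□ Φ) ⇔ ((Γ' : World) → proj₁ Γ □⊆ proj₁ Γ' → proj₁ Γ' Φ))
lemma20 em σ countable (Γ , Γ-saturated) Φ sΦ =
  mk⇔ (existence Γ-saturated) ◇-from-world , mk⇔ (λ □Φ∈Γ Δ Γ□⊆Δ → Γ□⊆Δ Φ □Φ∈Γ) □-from-worlds
  where
    open Worlds σ
    open ExistenceLemma em σ countable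
    open PrimeTheory σ (Saturated.prime Γ-saturated)

    inconsistent : (Δ : World) → proj₁ Δ Φ → ¬ proj₁ Δ (¬' Φ)
    inconsistent (_ , Δ-saturated) = PrimeTheory.∈-¬-contradiction σ (Saturated.prime Δ-saturated)

    ◇-from-world : Σ World (λ Δ → proj₁ Δ Φ × Γ □⊆ proj₁ Δ) → Γ (◇ Φ)
    ◇-from-world (Δ , Φ∈Δ , Γ□⊆Δ) =
      ∈-by-contradiction sΦ λ ¬◇Φ∈Γ → inconsistent Δ Φ∈Δ (Γ□⊆Δ (¬' Φ) (¬◇⇒□¬ ¬◇Φ∈Γ))

    □-from-worlds : ((Δ : World) → Γ □⊆ proj₁ Δ → proj₁ Δ Φ) → Γ (□ Φ)
    □-from-worlds Φ∈all = ∈-by-contradiction sΦ λ ¬□Φ∈Γ →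
      let Δ , ¬Φ∈Δ , Γ□⊆Δ = existence Γ-saturated (¬□⇒◇¬ ¬□Φ∈Γ) in inconsistent Δ (Φ∈all Δ Γ□⊆Δ) ¬Φ∈Δ
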